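{- Let $s,k\ge 2$ be integers. Every $2K_2$-split graph that is a minimal $(s,k)$-polar obstruction has at most $s+2k+2$ vertices.
   Context: All graphs are finite and simple. A graph $G$ is $2K_2$-split if $V_G$ has a partition $(C,S,I)$ with $C$ a clique, $I$ independent, $S=\varnothing$ or $G[S]\cong 2K_2$, every vertex of $C$ adjacent to every vertex of $S$, and no edges between $I$ and $S$. For nonnegative integers $s,k$, $G$ is $(s,k)$-polar if $V_G$ has a partition $(A,B)$ with $G[A]$ a complete multipartite graph with at most $s$ parts and $G[B]$ a disjoint union of at most $k$ complete graphs. A minimal $(s,k)$-polar obstruction is a graph that is not $(s,k)$-polar but every vertex-deleted subgraph of which is. -}

module Defs where

open import Data.Nat using (ℕ; zero; suc)
open import Data.Fin using (Fin; punchIn)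
open import Data.Bool using (Bool; true; false)
open import Data.Sum using (_⊎_; inj₁; inj₂)
open import Data.Product using (Σ; _×_; _,_; ∃-syntax; Σ-syntax)
open import Relation.Binary.PropositionalEquality using (_≡_; _≢_)
open import Relation.Nullary using (¬_)
open import Function.Bundles using (_⇔_)

record Graph (n : ℕ) : Set where
  field
    adj    : Fin n → Fin n → Bool
    sym    : ∀ u v → adj u v ≡ adj v u
    irrefl : ∀ v → adj v v ≡ false
open Graph public

_∼[_]_ : ∀ {n} → Fin n → Graph n → Fin n → Set
u ∼[ G ] v = adj G u v ≡ true

delete : ∀ {m} → Graph (suc m) → Fin (suc m) → Graph m
delete G v = record
  { adj    = λ i j → adj G (punchIn v i) (punchIn v j)
  ; sym    = λ i j → sym G (punchIn v i) (punchIn v j)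
  ; irrefl = λ i → irrefl G (punchIn v i)
  }

data Part : Set where
  C S I : Part

Is2K2 : ∀ {n} (G : Graph n) (X : Fin n → Set) → Set
Is2K2 {n} G X = ∃[ a ] ∃[ b ] ∃[ c ] ∃[ d ]
    ( a ≢ b × a ≢ c × a ≢ d × b ≢ c × b ≢ d × c ≢ d
    × (∀ x → X x ⇔ ((x ≡ a ⊎ x ≡ b) ⊎ (x ≡ c ⊎ x ≡ d)))
    × adj G a b ≡ true × adj G c d ≡ true
    × adj G a c ≡ false × adj G a d ≡ false
    × adj G b c ≡ false × adj G b d ≡ false )

TwoK2Split : ∀ {n} → Graph n → Set
TwoK2Split {n} G = Σ[ part ∈ (Fin n → Part) ]
    ( (∀ u v → part u ≡ C → part v ≡ C → u ≢ v → u ∼[ G ] v)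
    × (∀ u v → part u ≡ I → part v ≡ I → adj G u v ≡ false)
    × ((∀ x → ¬ (part x ≡ S)) ⊎ Is2K2 G (λ x → part x ≡ S))
    × (∀ u v → part u ≡ C → part v ≡ S → u ∼[ G ] v)
    × (∀ u v → part u ≡ I → part v ≡ S → adj G u v ≡ false) )

-- A partition (A,B) together with a labelling of A by ≤ s parts
-- (inj₁ i: vertex of A in part i) and of B by ≤ k cliques
-- (inj₂ j: vertex of B in clique j).
PolarLabelling : ∀ {n} (s k : ℕ) → Graph n → (Fin n → Fin s ⊎ Fin k) → Set
PolarLabelling {n} s k G σ =
    (∀ u v i j → σ u ≡ inj₁ i → σ v ≡ inj₁ j → u ≢ v → (u ∼[ G ] v ⇔ i ≢ j))
  × (∀ u v i j → σ u ≡ inj₂ i → σ v ≡ inj₂ j → u ≢ v → (u ∼[ G ] v ⇔ i ≡ j))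

Polar : ∀ {n} (s k : ℕ) → Graph n → Set
Polar {n} s k G = ∃[ σ ] PolarLabelling s k G σ

MinimalObstruction : ∀ {n} (s k : ℕ) → Graph n → Set
MinimalObstruction {zero}  s k G = ¬ Polar s k G
MinimalObstruction {suc m} s k G = ¬ Polar s k G × (∀ v → Polar s k (delete G v))

-- Let G be a 2K₂-split minimal (s,k)-polar obstruction with partition (C, S, I), where G[S]
-- consists of the edges ab and cd. Deleting a vertex v ∉ S gives a polar partition (A, B) of
-- G − v; as a, b, c cannot all lie in the complete multipartite part A, some S-vertex is in B.
-- If a C-vertex lies in B, all of S ∩ B is in its clique, so an edge of S lies in A, all of
-- I − v lies in B, and together with an S-vertex of B it is independent there: |I − v| < k.
-- If an I-vertex w lies in A, each edge of S has an endpoint in B, and every I-vertex of A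
-- has the same C-neighbourhood as w. Otherwise C − v is a clique in A or I − v is independent
-- in B. If n > s + 2k + 2 then |C| ≥ s + 2, or |C| ≥ s + 1 and |I| ≥ k, or |I| ≥ 2k − 1, and
-- in each case deleting one, two or three suitable vertices contradicts these bounds, using
-- that v cannot be put back: into a clique of B when v ∈ C has no I-neighbour, or into the
-- part of w when v ∈ I is a C-twin of w.

module Submission where

open import Defs renaming (sym to adj-sym)
open import Data.Nat using (ℕ; zero; suc; _≤_; _<_; _+_; _*_; z≤n; s≤s)
open import Data.Nat.Tactic.RingSolver using (solve-∀)
import Data.Nat.Properties as ℕ
open import Data.Fin using (Fin; fromℕ<; punchOut; _≟_)
import Data.Fin.Properties as Finₚ
open import Data.Bool using (true; false)
open import Data.Bool.Properties using (⇔→≡; ¬-not) renaming (_≟_ to _≟ᵇ_)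
open import Data.Sum using (_⊎_; inj₁; inj₂; [_,_]′)
open import Data.Sum.Properties using (inj₁-injective; inj₂-injective)
open import Data.Product using (_×_; _,_; ∃-syntax; ∃₂; proj₁; proj₂)
open import Data.List using (List; []; _∷_; _++_; length; lookup; map; filter; allFin)
open import Data.List.Properties using (length-++; length-map; length-tabulate)
open import Data.List.Membership.Propositional using (_∈_; _∉_)
open import Data.List.Membership.Propositional.Properties
  using (∈-lookup; ∈-filter⁺; ∈-filter⁻; ∈-allFin; ∈-map⁺; ∈-++⁺ˡ; ∈-++⁺ʳ; ∈-++⁻)
open import Data.List.Relation.Binary.Subset.Propositional using (_⊆_)
open import Data.List.Relation.Unary.Any using (here; there; index)
open import Data.List.Relation.Unary.Any.Properties using (lookup-index)
import Data.List.Relation.Unary.All as All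
open import Data.List.Relation.Unary.AllPairs using ([]; _∷_)
open import Data.List.Relation.Unary.Unique.Propositional using (Unique)
open import Data.List.Relation.Unary.Unique.Propositional.Properties using (filter⁺; allFin⁺; ++⁺)
open import Data.Empty using (⊥; ⊥-elim)
open import Relation.Nullary using (¬_; Dec; yes; no; ¬?; _×-dec_; _→-dec_; contradiction; decidable-stable)
open import Relation.Unary using (Decidable)
open import Relation.Binary.PropositionalEquality
  using (_≡_; _≢_; refl; sym; ≢-sym; trans; cong; cong₂; subst; module ≡-Reasoning)
open import Function using (id; _∘_)
open import Function.Bundles using (_⇔_; mk⇔; Equivalence)

-- Counting in duplicate-free lists

lookup-injective : {A : Set} {xs : List A} → Unique xs →
                   ∀ i j → lookup xs i ≡ lookup xs j → i ≡ j
lookup-injective {xs = x ∷ xs} (_ ∷ _)    Fin.zero    Fin.zero    _  = refl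
lookup-injective {xs = x ∷ xs} (x∉ ∷ _)   Fin.zero    (Fin.suc j) eq = contradiction eq (All.lookup x∉ (∈-lookup j))
lookup-injective {xs = x ∷ xs} (x∉ ∷ _)   (Fin.suc i) Fin.zero    eq = contradiction (sym eq) (All.lookup x∉ (∈-lookup i))
lookup-injective {xs = x ∷ xs} (_ ∷ uniq) (Fin.suc i) (Fin.suc j) eq = cong Fin.suc (lookup-injective uniq i j eq)

length-≤-injectiveOn : {A B : Set} {xs : List A} {ys : List B} (f : A → B) → Unique xs →
  (∀ {x} → x ∈ xs → f x ∈ ys) → (∀ {x y} → x ∈ xs → y ∈ xs → f x ≡ f y → x ≡ y) →
  length xs ≤ length ys
length-≤-injectiveOn {xs = xs} {ys} f uniq maps injective = Finₚ.injective⇒≤ g-injective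
  where
  open ≡-Reasoning
  g : Fin (length xs) → Fin (length ys)
  g i = index (maps (∈-lookup i))
  g-injective : ∀ {i j} → g i ≡ g j → i ≡ j
  g-injective {i} {j} eq = lookup-injective uniq i j (injective (∈-lookup i) (∈-lookup j) (begin
    f (lookup xs i)  ≡⟨ lookup-index (maps (∈-lookup i)) ⟩
    lookup ys (g i)  ≡⟨ cong (lookup ys) eq ⟩
    lookup ys (g j)  ≡⟨ lookup-index (maps (∈-lookup j)) ⟨
    f (lookup xs j)  ∎))

length-≤-⊆ : {A : Set} {xs ys : List A} → Unique xs → xs ⊆ ys → length xs ≤ length ys
length-≤-⊆ uniq xs⊆ys = length-≤-injectiveOn id uniq xs⊆ys (λ _ _ eq → eq)

length-≤-filter-++ : {A : Set} {P : A → Set} (P? : Decidable P) {xs : List A} → Unique xs →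
                     length xs ≤ length (filter P? xs) + length (filter (¬? ∘ P?) xs)
length-≤-filter-++ P? {xs} uniq =
  ℕ.≤-trans (length-≤-⊆ uniq split) (ℕ.≤-reflexive (length-++ (filter P? xs)))
  where
  split : xs ⊆ filter P? xs ++ filter (¬? ∘ P?) xs
  split {x} x∈ with P? x
  ... | yes Px = ∈-++⁺ˡ (∈-filter⁺ P? x∈ Px)
  ... | no ¬Px = ∈-++⁺ʳ (filter P? xs) (∈-filter⁺ (¬? ∘ P?) x∈ ¬Px)

∃∈-of-length : {A : Set} {xs : List A} → 1 ≤ length xs → ∃[ x ] x ∈ xs
∃∈-of-length {xs = x ∷ _} _ = x , here refl

without : ∀ {n} → Fin n → List (Fin n) → List (Fin n)
without v = filter (λ x → ¬? (x ≟ v))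

∈-without⁻ : ∀ {n} {v x : Fin n} {xs : List (Fin n)} → x ∈ without v xs → x ∈ xs × x ≢ v
∈-without⁻ {v = v} {xs = xs} = ∈-filter⁻ (λ x → ¬? (x ≟ v)) {xs = xs}

without-unique : ∀ {n} (v : Fin n) {xs : List (Fin n)} → Unique xs → Unique (without v xs)
without-unique v = filter⁺ (λ x → ¬? (x ≟ v))

length-≤-suc-without : ∀ {n} (v : Fin n) {xs : List (Fin n)} → Unique xs →
                       length xs ≤ suc (length (without v xs))
length-≤-suc-without v {xs} uniq = length-≤-⊆ uniq sub
  where
  sub : xs ⊆ v ∷ without v xs
  sub {x} x∈ with x ≟ v
  ... | yes refl = here refl
  ... | no x≢v   = there (∈-filter⁺ (λ x → ¬? (x ≟ v)) x∈ x≢v)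

length-≤-without-∉ : ∀ {n} {v : Fin n} {xs : List (Fin n)} → Unique xs → v ∉ xs →
                     length xs ≤ length (without v xs)
length-≤-without-∉ {v = v} uniq v∉ = length-≤-⊆ uniq λ {x} x∈ →
  ∈-filter⁺ (λ x → ¬? (x ≟ v)) x∈ λ { refl → v∉ x∈ }

-- Polar labellings of a graph with one vertex deleted

module _ {n : ℕ} (G : Graph n) where

  ∼-sym : ∀ {u w} → u ∼[ G ] w → w ∼[ G ] u
  ∼-sym {u} {w} u∼w = trans (adj-sym G w u) u∼w

  ≁-sym : ∀ {u w} → adj G u w ≡ false → adj G w u ≡ false
  ≁-sym {u} {w} u≁w = trans (adj-sym G w u) u≁w

  ∼⇒¬≁ : ∀ {u w} → u ∼[ G ] w → adj G u w ≢ false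
  ∼⇒¬≁ u∼w u≁w = contradiction (trans (sym u∼w) u≁w) λ ()

  ∼⇒≢ : ∀ {u w} → u ∼[ G ] w → u ≢ w
  ∼⇒≢ {u} u∼u refl = contradiction (trans (sym u∼u) (irrefl G u)) λ ()

  ∼⇔-sym : ∀ {L : Set} {R : L → L → Set} {u w i j} → (∀ {i j} → R i j → R j i) →
           (w ∼[ G ] u ⇔ R j i) → (u ∼[ G ] w ⇔ R i j)
  ∼⇔-sym R-sym e = mk⇔ (R-sym ∘ Equivalence.to e ∘ ∼-sym) (∼-sym ∘ Equivalence.from e ∘ R-sym)

-- No condition involves σ v, so any labelling of G − v lifts to one of these.
record PolarLabellingAwayFrom {n} (s k : ℕ) (G : Graph n) (v : Fin n)
                              (σ : Fin n → Fin s ⊎ Fin k) : Set where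
  field
    multipartite : ∀ u w i j → u ≢ v → w ≢ v → σ u ≡ inj₁ i → σ w ≡ inj₁ j → u ≢ w →
                   (u ∼[ G ] w ⇔ i ≢ j)
    cliqueUnion  : ∀ u w i j → u ≢ v → w ≢ v → σ u ≡ inj₂ i → σ w ≡ inj₂ j → u ≢ w →
                   (u ∼[ G ] w ⇔ i ≡ j)
open PolarLabellingAwayFrom

polarAwayFrom-delete : ∀ {m s k} (G : Graph (suc m)) (v : Fin (suc m)) → Fin s →
                       Polar s k (delete G v) → ∃[ σ ] PolarLabellingAwayFrom s k G v σ
polarAwayFrom-delete {m} {s} {k} G v i₀ (σ , polarA , polarB) = σ′ , record
  { multipartite = lift polarA ; cliqueUnion = lift polarB }
  where
  σ′ : Fin (suc m) → Fin s ⊎ Fin k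
  σ′ u with v ≟ u
  ... | yes _   = inj₁ i₀
  ... | no v≢u  = σ (punchOut v≢u)

  σ′-punchOut : ∀ {u} (v≢u : v ≢ u) → σ′ u ≡ σ (punchOut v≢u)
  σ′-punchOut {u} v≢u with v ≟ u
  ... | yes v≡u = contradiction v≡u v≢u
  ... | no _    = cong σ (Finₚ.punchOut-cong v refl)

  lift : ∀ {L : Set} {inj : L → Fin s ⊎ Fin k} {R : L → L → Set} →
    (∀ u w i j → σ u ≡ inj i → σ w ≡ inj j → u ≢ w → (u ∼[ delete G v ] w ⇔ R i j)) →
    ∀ u w i j → u ≢ v → w ≢ v → σ′ u ≡ inj i → σ′ w ≡ inj j → u ≢ w → (u ∼[ G ] w ⇔ R i j)
  lift {R = R} polar u w i j u≢v w≢v σ′u σ′w u≢w =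
    subst (λ b → (b ≡ true) ⇔ R i j)
          (cong₂ (adj G) (Finₚ.punchIn-punchOut v≢u) (Finₚ.punchIn-punchOut v≢w))
          (polar (punchOut v≢u) (punchOut v≢w) i j
                 (trans (sym (σ′-punchOut v≢u)) σ′u) (trans (sym (σ′-punchOut v≢w)) σ′w)
                 (u≢w ∘ Finₚ.punchOut-injective v≢u v≢w))
    where
    v≢u = ≢-sym u≢v
    v≢w = ≢-sym w≢v

module Extend {n s k} {G : Graph n} {v : Fin n} {σ : Fin n → Fin s ⊎ Fin k}
              (away : PolarLabellingAwayFrom s k G v σ) where

  private
    update : Fin s ⊎ Fin k → Fin n → Fin s ⊎ Fin k
    update τ u with u ≟ v
    ... | yes _ = τ
    ... | no _  = σ u

    extendComponent : ∀ {L : Set} {inj : L → Fin s ⊎ Fin k} {R : L → L → Set} τ →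
      (∀ {i j} → R i j → R j i) →
      (∀ u w i j → u ≢ v → w ≢ v → σ u ≡ inj i → σ w ≡ inj j → u ≢ w → (u ∼[ G ] w ⇔ R i j)) →
      (∀ w i j → w ≢ v → τ ≡ inj i → σ w ≡ inj j → (v ∼[ G ] w ⇔ R i j)) →
      ∀ u w i j → update τ u ≡ inj i → update τ w ≡ inj j → u ≢ w → (u ∼[ G ] w ⇔ R i j)
    extendComponent τ R-sym polar atV u w i j σu σw u≢w with u ≟ v | w ≟ v
    ... | yes refl | yes refl = contradiction refl u≢w
    ... | yes refl | no w≢v   = atV w i j w≢v σu σw
    ... | no u≢v   | yes refl = ∼⇔-sym G {i = i} {j} R-sym (atV u j i u≢v σw σu)
    ... | no u≢v   | no w≢v   = polar u w i j u≢v w≢v σu σw u≢w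

  extendIntoPart : (i : Fin s) → (∀ w j → w ≢ v → σ w ≡ inj₁ j → (v ∼[ G ] w ⇔ i ≢ j)) → Polar s k G
  extendIntoPart i atV = update (inj₁ i)
    , extendComponent (inj₁ i) ≢-sym (multipartite away) (λ { w _ j w≢v refl σw → atV w j w≢v σw })
    , extendComponent (inj₁ i) sym (cliqueUnion away) (λ { _ _ _ _ () _ })

  extendIntoClique : (q : Fin k) → (∀ w j → w ≢ v → σ w ≡ inj₂ j → (v ∼[ G ] w ⇔ q ≡ j)) → Polar s k G
  extendIntoClique q atV = update (inj₂ q)
    , extendComponent (inj₂ q) ≢-sym (multipartite away) (λ { _ _ _ _ () _ })
    , extendComponent (inj₂ q) sym (cliqueUnion away) (λ { w _ j w≢v refl σw → atV w j w≢v σw })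

InA InB : ∀ {n s k} → (Fin n → Fin s ⊎ Fin k) → Fin n → Set
InA σ x = ∃[ i ] σ x ≡ inj₁ i
InB σ x = ∃[ q ] σ x ≡ inj₂ q

inA⊎inB : ∀ {n s k} (σ : Fin n → Fin s ⊎ Fin k) x → InA σ x ⊎ InB σ x
inA⊎inB σ x with σ x
... | inj₁ i = inj₁ (i , refl)
... | inj₂ q = inj₂ (q , refl)

module _ {n s k} (σ : Fin n → Fin s ⊎ Fin k) where

  inA? : ∀ x → Dec (InA σ x)
  inA? x with σ x
  ... | inj₁ i = yes (i , refl)
  ... | inj₂ _ = no λ ()

  inB? : ∀ x → Dec (InB σ x)
  inB? x with σ x
  ... | inj₁ _ = no λ ()
  ... | inj₂ q = yes (q , refl)

Clique Independent : ∀ {n} → Graph n → List (Fin n) → Set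
Clique      G xs = ∀ {x y} → x ∈ xs → y ∈ xs → x ≢ y → x ∼[ G ] y
Independent G xs = ∀ {x y} → x ∈ xs → y ∈ xs → adj G x y ≡ false

Independent-∷ : ∀ {n} (G : Graph n) {r xs} → (∀ {y} → y ∈ xs → adj G r y ≡ false) →
                Independent G xs → Independent G (r ∷ xs)
Independent-∷ G r≁xs ind (here refl) (here refl) = irrefl G _
Independent-∷ G r≁xs ind (here refl) (there y∈)  = r≁xs y∈
Independent-∷ G r≁xs ind (there x∈)  (here refl) = ≁-sym G (r≁xs x∈)
Independent-∷ G r≁xs ind (there x∈)  (there y∈)  = ind x∈ y∈

Clique-∷ : ∀ {n} (G : Graph n) {r xs} → (∀ {y} → y ∈ xs → r ∼[ G ] y) → Clique G xs → Clique G (r ∷ xs)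
Clique-∷ G r∼xs clique (here refl) (here refl) x≢y = contradiction refl x≢y
Clique-∷ G r∼xs clique (here refl) (there y∈)  _   = r∼xs y∈
Clique-∷ G r∼xs clique (there x∈)  (here refl) _   = ∼-sym G (r∼xs x∈)
Clique-∷ G r∼xs clique (there x∈)  (there y∈)  x≢y = clique x∈ y∈ x≢y

module AwayFrom {n s k} {G : Graph n} {v : Fin n} {σ : Fin n → Fin s ⊎ Fin k}
                (away : PolarLabellingAwayFrom s k G v σ) where

  module _ {u w : Fin n} (u≢v : u ≢ v) (w≢v : w ≢ v) where

    module _ {i j : Fin s} (σu : σ u ≡ inj₁ i) (σw : σ w ≡ inj₁ j) where

      A-∼⇒≢ : u ∼[ G ] w → i ≢ j
      A-∼⇒≢ u∼w = Equivalence.to (multipartite away u w i j u≢v w≢v σu σw (∼⇒≢ G u∼w)) u∼w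

      A-≢⇒∼ : i ≢ j → u ∼[ G ] w
      A-≢⇒∼ i≢j with u ≟ w
      ... | yes refl = contradiction (inj₁-injective (trans (sym σu) σw)) i≢j
      ... | no u≢w   = Equivalence.from (multipartite away u w i j u≢v w≢v σu σw u≢w) i≢j

      A-≁⇒≡ : adj G u w ≡ false → i ≡ j
      A-≁⇒≡ u≁w with i ≟ j
      ... | yes i≡j = i≡j
      ... | no i≢j  = contradiction (trans (sym (A-≢⇒∼ i≢j)) u≁w) λ ()

    module _ {i j : Fin k} (σu : σ u ≡ inj₂ i) (σw : σ w ≡ inj₂ j) where

      B-∼⇒≡ : u ∼[ G ] w → i ≡ j
      B-∼⇒≡ u∼w = Equivalence.to (cliqueUnion away u w i j u≢v w≢v σu σw (∼⇒≢ G u∼w)) u∼w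

      B-≡⇒∼ : u ≢ w → i ≡ j → u ∼[ G ] w
      B-≡⇒∼ u≢w = Equivalence.from (cliqueUnion away u w i j u≢v w≢v σu σw u≢w)

      B-≁⇒≢ : u ≢ w → adj G u w ≡ false → i ≢ j
      B-≁⇒≢ u≢w u≁w i≡j = contradiction (trans (sym (B-≡⇒∼ u≢w i≡j)) u≁w) λ ()

  A-noInducedK₂+K₁ : ∀ {x y z} → x ≢ v → y ≢ v → z ≢ v → InA σ x → InA σ y → InA σ z →
                     x ∼[ G ] y → adj G x z ≡ false → adj G y z ≡ false → ⊥
  A-noInducedK₂+K₁ x≢v y≢v z≢v (i , σx) (j , σy) (l , σz) x∼y x≁z y≁z =
    A-∼⇒≢ x≢v y≢v σx σy x∼y (trans (A-≁⇒≡ x≢v z≢v σx σz x≁z) (sym (A-≁⇒≡ y≢v z≢v σy σz y≁z)))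

  someInB⊎allInA : ∀ {P : Fin n → Set} → Decidable P →
                   (∃[ x ] P x × x ≢ v × InB σ x) ⊎ (∀ x → P x → x ≢ v → InA σ x)
  someInB⊎allInA P? with Finₚ.any? (λ x → P? x ×-dec ¬? (x ≟ v) ×-dec inB? σ x)
  ... | yes found = inj₁ found
  ... | no none   = inj₂ λ x Px x≢v → [ id , (λ x∈B → ⊥-elim (none (x , Px , x≢v , x∈B))) ]′ (inA⊎inB σ x)

  someInA⊎allInB : ∀ {P : Fin n → Set} → Decidable P →
                   (∃[ x ] P x × x ≢ v × InA σ x) ⊎ (∀ x → P x → x ≢ v → InB σ x)
  someInA⊎allInB P? with Finₚ.any? (λ x → P? x ×-dec ¬? (x ≟ v) ×-dec inA? σ x)
  ... | yes found = inj₁ found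
  ... | no none   = inj₂ λ x Px x≢v → [ (λ x∈A → ⊥-elim (none (x , Px , x≢v , x∈A))) , id ]′ (inA⊎inB σ x)

  module _ {xs : List (Fin n)} (alive : ∀ {x} → x ∈ xs → x ≢ v) where

    A-clique-injective : (∀ {x} → x ∈ xs → InA σ x) → Clique G xs →
                         ∀ {x y} → x ∈ xs → y ∈ xs → σ x ≡ σ y → x ≡ y
    A-clique-injective inA clique {x} {y} x∈ y∈ σx≡σy with x ≟ y | inA x∈ | inA y∈
    ... | yes x≡y | _        | _        = x≡y
    ... | no x≢y  | i , σx   | j , σy   =
      contradiction (inj₁-injective (trans (sym σx) (trans σx≡σy σy)))
                    (A-∼⇒≢ (alive x∈) (alive y∈) σx σy (clique x∈ y∈ x≢y))

    A-clique-bound : Unique xs → (∀ {x} → x ∈ xs → InA σ x) → Clique G xs → length xs ≤ s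
    A-clique-bound uniq inA clique = ℕ.≤-trans
      (length-≤-injectiveOn σ uniq parts (A-clique-injective inA clique))
      (ℕ.≤-reflexive (trans (length-map inj₁ (allFin s)) (length-tabulate id)))
      where
      parts : ∀ {x} → x ∈ xs → σ x ∈ map inj₁ (allFin s)
      parts x∈ with inA x∈
      ... | i , σx = subst (_∈ map inj₁ (allFin s)) (sym σx) (∈-map⁺ inj₁ (∈-allFin i))

    B-independent-bound : Unique xs → (∀ {x} → x ∈ xs → InB σ x) → Independent G xs → length xs ≤ k
    B-independent-bound uniq inB independent = ℕ.≤-trans
      (length-≤-injectiveOn σ uniq cliques injective)
      (ℕ.≤-reflexive (trans (length-map inj₂ (allFin k)) (length-tabulate id)))
      where
      cliques : ∀ {x} → x ∈ xs → σ x ∈ map inj₂ (allFin k)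
      cliques x∈ with inB x∈
      ... | q , σx = subst (_∈ map inj₂ (allFin k)) (sym σx) (∈-map⁺ inj₂ (∈-allFin q))
      injective : ∀ {x y} → x ∈ xs → y ∈ xs → σ x ≡ σ y → x ≡ y
      injective {x} {y} x∈ y∈ σx≡σy with x ≟ y | inB x∈ | inB y∈
      ... | yes x≡y | _      | _      = x≡y
      ... | no x≢y  | q , σx | r , σy =
        contradiction (inj₂-injective (trans (sym σx) (trans σx≡σy σy)))
                      (B-≁⇒≢ (alive x∈) (alive y∈) σx σy x≢y (independent x∈ y∈))

-- Size arithmetic

twiceNotBelow : ∀ {k m} → 2 ≤ k → k + k ≤ suc m → ¬ m ≤ k
twiceNotBelow {k} 2≤k 2k≤1+m m≤k = ℕ.≤⇒≯ (ℕ.+-cancelʳ-≤ k k 1 (ℕ.≤-trans 2k≤1+m (s≤s m≤k))) 2≤k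

sizeCases : ∀ {s k c i} → 2 ≤ k → s + 2 * k + 2 < c + (i + 4) →
            k + k ≤ suc i ⊎ (suc s ≤ c × k ≤ i) ⊎ suc (suc s) ≤ c
sizeCases {s} {k} {c} {i} 2≤k bound with k + k ℕ.≤? suc i | k ℕ.≤? i
... | yes 2k≤1+i | _      = inj₁ 2k≤1+i
... | no 2k≰1+i  | yes k≤i = inj₂ (inj₁ (ℕ.+-cancelʳ-≤ (i + 4) (suc s) c (begin
  suc s + (i + 4)        ≡⟨ eq₁ s i ⟩
  s + suc (suc i) + 3    ≤⟨ ℕ.+-monoˡ-≤ 3 (ℕ.+-monoʳ-≤ s (ℕ.≰⇒> 2k≰1+i)) ⟩
  s + (k + k) + 3        ≡⟨ eq₂ s k ⟩
  suc (s + 2 * k + 2)    ≤⟨ bound ⟩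
  c + (i + 4)            ∎) , k≤i))
  where
  open ℕ.≤-Reasoning
  eq₁ : ∀ s i → suc s + (i + 4) ≡ s + suc (suc i) + 3
  eq₁ = solve-∀
  eq₂ : ∀ s k → s + (k + k) + 3 ≡ suc (s + 2 * k + 2)
  eq₂ = solve-∀
... | no _       | no k≰i  = inj₂ (inj₂ (ℕ.+-cancelʳ-≤ (i + 4) (suc (suc s)) c (begin
  suc (suc s) + (i + 4)  ≡⟨ eq₁ s i ⟩
  (s + suc i) + (2 + 3)  ≤⟨ ℕ.+-mono-≤ (ℕ.+-monoʳ-≤ s (ℕ.≰⇒> k≰i)) (ℕ.+-monoˡ-≤ 3 2≤k) ⟩
  (s + k) + (k + 3)      ≡⟨ eq₂ s k ⟩
  suc (s + 2 * k + 2)    ≤⟨ bound ⟩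
  c + (i + 4)            ∎)))
  where
  open ℕ.≤-Reasoning
  eq₁ : ∀ s i → suc (suc s) + (i + 4) ≡ (s + suc i) + (2 + 3)
  eq₁ = solve-∀
  eq₂ : ∀ s k → (s + k) + (k + 3) ≡ suc (s + 2 * k + 2)
  eq₂ = solve-∀

-- 2K₂-split graphs

_≟ₚ_ : (p q : Part) → Dec (p ≡ q)
C ≟ₚ C = yes refl
C ≟ₚ S = no λ ()
C ≟ₚ I = no λ ()
S ≟ₚ C = no λ ()
S ≟ₚ S = yes refl
S ≟ₚ I = no λ ()
I ≟ₚ C = no λ ()
I ≟ₚ S = no λ ()
I ≟ₚ I = yes refl

splitGraph-polar : ∀ {n s k} (G : Graph n) (part : Fin n → Part) → Fin s → Fin k →
  (∀ u w → part u ≡ C → part w ≡ C → u ≢ w → u ∼[ G ] w) →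
  (∀ u w → part u ≡ I → part w ≡ I → adj G u w ≡ false) →
  (∀ x → ¬ part x ≡ S) → Polar s k G
splitGraph-polar {s = s} {k} G part i₀ q₀ C-clique I-independent noS = label ∘ part , I-part , C-clique′
  where
  label : Part → Fin s ⊎ Fin k
  label C = inj₂ q₀
  label S = inj₁ i₀
  label I = inj₁ i₀
  inA⇒I : ∀ {u i} → label (part u) ≡ inj₁ i → part u ≡ I × i ≡ i₀
  inA⇒I {u} σu with part u in u∈
  ... | I = refl , inj₁-injective (sym σu)
  ... | S = ⊥-elim (noS u u∈)
  inB⇒C : ∀ {u q} → label (part u) ≡ inj₂ q → part u ≡ C × q ≡ q₀
  inB⇒C {u} σu with part u in u∈
  ... | C = refl , inj₂-injective (sym σu)
  I-part : ∀ u w i j → label (part u) ≡ inj₁ i → label (part w) ≡ inj₁ j → u ≢ w → (u ∼[ G ] w ⇔ i ≢ j)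
  I-part u w i j σu σw _ with inA⇒I σu | inA⇒I σw
  ... | u∈I , refl | w∈I , refl = mk⇔ (λ u∼w → ⊥-elim (∼⇒¬≁ G u∼w (I-independent u w u∈I w∈I)))
                                      (λ i₀≢i₀ → ⊥-elim (i₀≢i₀ refl))
  C-clique′ : ∀ u w i j → label (part u) ≡ inj₂ i → label (part w) ≡ inj₂ j → u ≢ w → (u ∼[ G ] w ⇔ i ≡ j)
  C-clique′ u w i j σu σw u≢w with inB⇒C σu | inB⇒C σw
  ... | u∈C , refl | w∈C , refl = mk⇔ (λ _ → refl) (λ _ → C-clique u w u∈C w∈C u≢w)

module Split {n : ℕ} (G : Graph n) (part : Fin n → Part)
  (C-clique : ∀ u w → part u ≡ C → part w ≡ C → u ≢ w → u ∼[ G ] w)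
  (I-independent : ∀ u w → part u ≡ I → part w ≡ I → adj G u w ≡ false)
  (C-S-complete : ∀ u w → part u ≡ C → part w ≡ S → u ∼[ G ] w)
  (I-S-anticomplete : ∀ u w → part u ≡ I → part w ≡ S → adj G u w ≡ false)
  {a b c d : Fin n} (a∈S : part a ≡ S) (b∈S : part b ≡ S) (c∈S : part c ≡ S) (d∈S : part d ≡ S)
  (a≢c : a ≢ c) (a≢d : a ≢ d) (b≢c : b ≢ c) (b≢d : b ≢ d)
  (a∼b : a ∼[ G ] b) (c∼d : c ∼[ G ] d)
  (a≁c : adj G a c ≡ false) (a≁d : adj G a d ≡ false) (b≁c : adj G b c ≡ false) (b≁d : adj G b d ≡ false)
  where

  part-≢ : ∀ {u w p q} → part u ≡ p → part w ≡ q → p ≢ q → u ≢ w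
  part-≢ refl w∈q p≢q refl = p≢q w∈q

  members : Part → List (Fin n)
  members p = filter (λ x → part x ≟ₚ p) (allFin n)

  members-unique : ∀ p → Unique (members p)
  members-unique p = filter⁺ (λ x → part x ≟ₚ p) (allFin⁺ n)

  ∈-members⁺ : ∀ {x p} → part x ≡ p → x ∈ members p
  ∈-members⁺ {x} {p} = ∈-filter⁺ (λ x → part x ≟ₚ p) (∈-allFin x)

  ∈-members⁻ : ∀ {x p} → x ∈ members p → part x ≡ p
  ∈-members⁻ {p = p} x∈ = proj₂ (∈-filter⁻ (λ x → part x ≟ₚ p) {xs = allFin n} x∈)

  Cs Is : List (Fin n)
  Cs = members C
  Is = members I

  vertexCount : (∀ x → part x ≡ S → (x ≡ a ⊎ x ≡ b) ⊎ (x ≡ c ⊎ x ≡ d)) →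
                n ≤ length Cs + (length Is + 4)
  vertexCount S⊆abcd = begin
    n                                        ≡⟨ length-tabulate id ⟨
    length (allFin n)                        ≤⟨ length-≤-⊆ (allFin⁺ n) cover ⟩
    length (Cs ++ Is ++ a ∷ b ∷ c ∷ d ∷ [])  ≡⟨ length-++ Cs ⟩
    length Cs + length (Is ++ a ∷ b ∷ c ∷ d ∷ [])  ≡⟨ cong (length Cs +_) (length-++ Is) ⟩
    length Cs + (length Is + 4)              ∎
    where
    open ℕ.≤-Reasoning
    cover : allFin n ⊆ Cs ++ Is ++ a ∷ b ∷ c ∷ d ∷ []
    cover {x} _ with part x in x∈
    ... | C = ∈-++⁺ˡ (∈-members⁺ x∈)
    ... | I = ∈-++⁺ʳ Cs (∈-++⁺ˡ (∈-members⁺ x∈))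
    ... | S with S⊆abcd x x∈
    ...   | inj₁ (inj₁ refl) = ∈-++⁺ʳ Cs (∈-++⁺ʳ Is (here refl))
    ...   | inj₁ (inj₂ refl) = ∈-++⁺ʳ Cs (∈-++⁺ʳ Is (there (here refl)))
    ...   | inj₂ (inj₁ refl) = ∈-++⁺ʳ Cs (∈-++⁺ʳ Is (there (there (here refl))))
    ...   | inj₂ (inj₂ refl) = ∈-++⁺ʳ Cs (∈-++⁺ʳ Is (there (there (there (here refl)))))

  ab-cd-nonadjacent : ∀ {t t′} → (t ≡ a ⊎ t ≡ b) → (t′ ≡ c ⊎ t′ ≡ d) →
                      part t ≡ S × part t′ ≡ S × t ≢ t′ × adj G t t′ ≡ false
  ab-cd-nonadjacent (inj₁ refl) (inj₁ refl) = a∈S , c∈S , a≢c , a≁c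
  ab-cd-nonadjacent (inj₁ refl) (inj₂ refl) = a∈S , d∈S , a≢d , a≁d
  ab-cd-nonadjacent (inj₂ refl) (inj₁ refl) = b∈S , c∈S , b≢c , b≁c
  ab-cd-nonadjacent (inj₂ refl) (inj₂ refl) = b∈S , d∈S , b≢d , b≁d

  ∈-without-members⁻ : ∀ {v x p} → x ∈ without v (members p) → part x ≡ p × x ≢ v
  ∈-without-members⁻ x∈ with ∈-without⁻ x∈
  ... | x∈p , x≢v = ∈-members⁻ x∈p , x≢v

  someMember : ∀ {p} → 1 ≤ length (members p) → ∃[ x ] part x ≡ p
  someMember 1≤ = let x , x∈ = ∃∈-of-length 1≤ in x , ∈-members⁻ x∈

  someMemberOtherThan : ∀ {p} → 2 ≤ length (members p) → ∀ y → ∃[ x ] part x ≡ p × x ≢ y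
  someMemberOtherThan {p} 2≤ y =
    let x , x∈ = ∃∈-of-length (ℕ.≤-pred (ℕ.≤-trans 2≤ (length-≤-suc-without y (members-unique p))))
    in x , ∈-without-members⁻ x∈

  HasINeighbour : Fin n → Set
  HasINeighbour x = ∃[ y ] part y ≡ I × x ∼[ G ] y

  hasINeighbour? : ∀ x → Dec (HasINeighbour x)
  hasINeighbour? x = Finₚ.any? (λ y → (part y ≟ₚ I) ×-dec (adj G x y ≟ᵇ true))

  CTwins : Fin n → Fin n → Set
  CTwins y w = ∀ u → part u ≡ C → adj G u y ≡ adj G u w

  cTwins? : ∀ y w → Dec (CTwins y w)
  cTwins? y w = Finₚ.all? (λ u → (part u ≟ₚ C) →-dec (adj G u y ≟ᵇ adj G u w))

  isC? : ∀ x → Dec (part x ≡ C)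
  isC? x = part x ≟ₚ C

  isI? : ∀ x → Dec (part x ≡ I)
  isI? x = part x ≟ₚ I

  ≡⇒≢ : ∀ {x p q} → part x ≡ p → p ≢ q → part x ≢ q
  ≡⇒≢ refl p≢q = p≢q

  module Away {s k : ℕ} {v : Fin n} (v∉S : part v ≢ S) {σ : Fin n → Fin s ⊎ Fin k}
              (away : PolarLabellingAwayFrom s k G v σ) where

    open AwayFrom away public

    S-alive : ∀ {r} → part r ≡ S → r ≢ v
    S-alive r∈S refl = v∉S r∈S

    someS-inB : ∃[ r ] part r ≡ S × InB σ r
    someS-inB with inA⊎inB σ a | inA⊎inB σ b | inA⊎inB σ c
    ... | inj₂ a∈B | _        | _        = a , a∈S , a∈B
    ... | inj₁ _   | inj₂ b∈B | _        = b , b∈S , b∈B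
    ... | inj₁ _   | inj₁ _   | inj₂ c∈B = c , c∈S , c∈B
    ... | inj₁ a∈A | inj₁ b∈A | inj₁ c∈A = ⊥-elim
      (A-noInducedK₂+K₁ (S-alive a∈S) (S-alive b∈S) (S-alive c∈S) a∈A b∈A c∈A a∼b a≁c b≁c)

    S∪I-independent-bound : ∀ {ts ys} → Unique ts → (∀ {t} → t ∈ ts → part t ≡ S × InB σ t) →
      Independent G ts → Unique ys → (∀ {y} → y ∈ ys → part y ≡ I × y ≢ v × InB σ y) →
      length ts + length ys ≤ k
    S∪I-independent-bound {ts} {ys} ts-unique ts⊆S ts-independent ys-unique ys⊆I =
      ℕ.≤-trans (ℕ.≤-reflexive (sym (length-++ ts)))
                (B-independent-bound alive (++⁺ ts-unique ys-unique disjoint) inB independent)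
      where
      disjoint : ∀ {x} → ¬ (x ∈ ts × x ∈ ys)
      disjoint (x∈ts , x∈ys) = part-≢ (proj₁ (ts⊆S x∈ts)) (proj₁ (ys⊆I x∈ys)) (λ ()) refl
      alive : ∀ {x} → x ∈ ts ++ ys → x ≢ v
      alive x∈ with ∈-++⁻ ts x∈
      ... | inj₁ x∈ts = S-alive (proj₁ (ts⊆S x∈ts))
      ... | inj₂ x∈ys = proj₁ (proj₂ (ys⊆I x∈ys))
      inB : ∀ {x} → x ∈ ts ++ ys → InB σ x
      inB x∈ with ∈-++⁻ ts x∈
      ... | inj₁ x∈ts = proj₂ (ts⊆S x∈ts)
      ... | inj₂ x∈ys = proj₂ (proj₂ (ys⊆I x∈ys))
      independent : Independent G (ts ++ ys)
      independent x∈ y∈ with ∈-++⁻ ts x∈ | ∈-++⁻ ts y∈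
      ... | inj₁ x∈ts | inj₁ y∈ts = ts-independent x∈ts y∈ts
      ... | inj₁ x∈ts | inj₂ y∈ys = ≁-sym G (I-S-anticomplete _ _ (proj₁ (ys⊆I y∈ys)) (proj₁ (ts⊆S x∈ts)))
      ... | inj₂ x∈ys | inj₁ y∈ts = I-S-anticomplete _ _ (proj₁ (ys⊆I x∈ys)) (proj₁ (ts⊆S y∈ts))
      ... | inj₂ x∈ys | inj₂ y∈ys = I-independent _ _ (proj₁ (ys⊆I x∈ys)) (proj₁ (ys⊆I y∈ys))

    S∪C-clique-bound : ∀ {ps xs} → Unique ps → (∀ {p} → p ∈ ps → part p ≡ S × InA σ p) →
      Clique G ps → Unique xs → (∀ {x} → x ∈ xs → part x ≡ C × x ≢ v × InA σ x) →
      length ps + length xs ≤ s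
    S∪C-clique-bound {ps} {xs} ps-unique ps⊆S ps-clique xs-unique xs⊆C =
      ℕ.≤-trans (ℕ.≤-reflexive (sym (length-++ ps)))
                (A-clique-bound alive (++⁺ ps-unique xs-unique disjoint) inA clique)
      where
      disjoint : ∀ {x} → ¬ (x ∈ ps × x ∈ xs)
      disjoint (x∈ps , x∈xs) = part-≢ (proj₁ (ps⊆S x∈ps)) (proj₁ (xs⊆C x∈xs)) (λ ()) refl
      alive : ∀ {x} → x ∈ ps ++ xs → x ≢ v
      alive x∈ with ∈-++⁻ ps x∈
      ... | inj₁ x∈ps = S-alive (proj₁ (ps⊆S x∈ps))
      ... | inj₂ x∈xs = proj₁ (proj₂ (xs⊆C x∈xs))
      inA : ∀ {x} → x ∈ ps ++ xs → InA σ x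
      inA x∈ with ∈-++⁻ ps x∈
      ... | inj₁ x∈ps = proj₂ (ps⊆S x∈ps)
      ... | inj₂ x∈xs = proj₂ (proj₂ (xs⊆C x∈xs))
      clique : Clique G (ps ++ xs)
      clique x∈ y∈ x≢y with ∈-++⁻ ps x∈ | ∈-++⁻ ps y∈
      ... | inj₁ x∈ps | inj₁ y∈ps = ps-clique x∈ps y∈ps x≢y
      ... | inj₁ x∈ps | inj₂ y∈xs = ∼-sym G (C-S-complete _ _ (proj₁ (xs⊆C y∈xs)) (proj₁ (ps⊆S x∈ps)))
      ... | inj₂ x∈xs | inj₁ y∈ps = C-S-complete _ _ (proj₁ (xs⊆C x∈xs)) (proj₁ (ps⊆S y∈ps))
      ... | inj₂ x∈xs | inj₂ y∈xs = C-clique _ _ (proj₁ (xs⊆C x∈xs)) (proj₁ (xs⊆C y∈xs)) x≢y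

    aliveI-inB⇒bound : (∀ y → part y ≡ I → y ≢ v → InB σ y) → suc (length (without v Is)) ≤ k
    aliveI-inB⇒bound I⊆B with someS-inB
    ... | r , r∈S , r∈B = S∪I-independent-bound (All.[] ∷ []) (λ { (here refl) → r∈S , r∈B })
      (Independent-∷ G (λ ()) (λ ())) (without-unique v (members-unique I))
      (λ y∈ → let y∈I , y≢v = ∈-without-members⁻ y∈ in y∈I , y≢v , I⊆B _ y∈I y≢v)

    aliveI-inB⇒|I|≤k : (∀ y → part y ≡ I → y ≢ v → InB σ y) → length Is ≤ k
    aliveI-inB⇒|I|≤k I⊆B = ℕ.≤-trans (length-≤-suc-without v (members-unique I)) (aliveI-inB⇒bound I⊆B)

    aliveI-inB⇒|I|<k : part v ≢ I → (∀ y → part y ≡ I → y ≢ v → InB σ y) → length Is < k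
    aliveI-inB⇒|I|<k v∉I I⊆B = ℕ.≤-trans
      (s≤s (length-≤-without-∉ (members-unique I) (v∉I ∘ ∈-members⁻))) (aliveI-inB⇒bound I⊆B)

    aliveC-inA⇒bound : (∀ x → part x ≡ C → x ≢ v → InA σ x) → length (without v Cs) ≤ s
    aliveC-inA⇒bound C⊆A = S∪C-clique-bound [] (λ ()) (λ ()) (without-unique v (members-unique C))
      (λ x∈ → let x∈C , x≢v = ∈-without-members⁻ x∈ in x∈C , x≢v , C⊆A _ x∈C x≢v)

    aliveC-inA⇒|C|≤1+s : (∀ x → part x ≡ C → x ≢ v → InA σ x) → length Cs ≤ suc s
    aliveC-inA⇒|C|≤1+s C⊆A = ℕ.≤-trans (length-≤-suc-without v (members-unique C)) (s≤s (aliveC-inA⇒bound C⊆A))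

    aliveC-inA⇒|C|≤s : part v ≢ C → (∀ x → part x ≡ C → x ≢ v → InA σ x) → length Cs ≤ s
    aliveC-inA⇒|C|≤s v∉C C⊆A = ℕ.≤-trans
      (length-≤-without-∉ (members-unique C) (v∉C ∘ ∈-members⁻)) (aliveC-inA⇒bound C⊆A)

    C-nonNeighbours-bound : ∀ {y xs} → y ≢ v → InA σ y → Unique xs →
      (∀ {u} → u ∈ xs → part u ≡ C × u ≢ v × InA σ u × adj G u y ≡ false) → length xs ≤ 1
    C-nonNeighbours-bound {y} {xs} y≢v (iy , σy) xs-unique xs⊆C = length-≤-injectiveOn σ xs-unique sameLabelAsY
      (A-clique-injective (proj₁ ∘ proj₂ ∘ xs⊆C) (proj₁ ∘ proj₂ ∘ proj₂ ∘ xs⊆C)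
        (λ u∈ u′∈ → C-clique _ _ (proj₁ (xs⊆C u∈)) (proj₁ (xs⊆C u′∈))))
      where
      sameLabelAsY : ∀ {u} → u ∈ xs → σ u ∈ σ y ∷ []
      sameLabelAsY u∈ with xs⊆C u∈
      ... | _ , u≢v , (iu , σu) , u≁y =
        here (trans σu (trans (cong inj₁ (A-≁⇒≡ u≢v y≢v σu σy u≁y)) (sym σy)))

    module CVertexInB {x : Fin n} {q : Fin k} (x∈C : part x ≡ C) (x≢v : x ≢ v) (σx : σ x ≡ inj₂ q) where

      C-inB⇒inClique : ∀ {u q′} → part u ≡ C → u ≢ v → σ u ≡ inj₂ q′ → q′ ≡ q
      C-inB⇒inClique {u} u∈C u≢v σu with u ≟ x
      ... | yes refl = inj₂-injective (trans (sym σu) σx)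
      ... | no u≢x   = B-∼⇒≡ u≢v x≢v σu σx (C-clique u x u∈C x∈C u≢x)

      S-inB⇒inClique : ∀ {r q′} → part r ≡ S → σ r ≡ inj₂ q′ → q′ ≡ q
      S-inB⇒inClique r∈S σr = sym (B-∼⇒≡ x≢v (S-alive r∈S) σx σr (C-S-complete _ _ x∈C r∈S))

      I-notInClique : ∀ {y} → part y ≡ I → y ≢ v → σ y ≢ inj₂ q
      I-notInClique y∈I y≢v σy with someS-inB
      ... | r , r∈S , q′ , σr = ∼⇒¬≁ G
        (B-≡⇒∼ y≢v (S-alive r∈S) σy σr (part-≢ y∈I r∈S λ ()) (sym (S-inB⇒inClique r∈S σr)))
        (I-S-anticomplete _ _ y∈I r∈S)

      S-nonadjacent-inA : ∀ {r r′} → part r ≡ S → part r′ ≡ S → InB σ r → r ≢ r′ →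
                          adj G r r′ ≡ false → InA σ r′
      S-nonadjacent-inA r∈S r′∈S (qr , σr) r≢r′ r≁r′ with inA⊎inB σ _
      ... | inj₁ r′∈A         = r′∈A
      ... | inj₂ (qr′ , σr′)  = ⊥-elim (B-≁⇒≢ (S-alive r∈S) (S-alive r′∈S) σr σr′ r≢r′ r≁r′
                                  (trans (S-inB⇒inClique r∈S σr) (sym (S-inB⇒inClique r′∈S σr′))))

      S-edge-inA : ∃₂ λ p p′ → part p ≡ S × part p′ ≡ S × p ∼[ G ] p′ × InA σ p × InA σ p′
      S-edge-inA with inA⊎inB σ a | inA⊎inB σ b
      ... | inj₁ a∈A | inj₁ b∈A = a , b , a∈S , b∈S , a∼b , a∈A , b∈A
      ... | inj₂ a∈B | _        = c , d , c∈S , d∈S , c∼d ,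
        S-nonadjacent-inA a∈S c∈S a∈B a≢c a≁c , S-nonadjacent-inA a∈S d∈S a∈B a≢d a≁d
      ... | inj₁ _   | inj₂ b∈B = c , d , c∈S , d∈S , c∼d ,
        S-nonadjacent-inA b∈S c∈S b∈B b≢c b≁c , S-nonadjacent-inA b∈S d∈S b∈B b≢d b≁d

      I-inB : ∀ {y} → part y ≡ I → y ≢ v → InB σ y
      I-inB y∈I y≢v with inA⊎inB σ _ | S-edge-inA
      ... | inj₂ y∈B | _ = y∈B
      ... | inj₁ y∈A | p , p′ , p∈S , p′∈S , p∼p′ , p∈A , p′∈A = ⊥-elim
        (A-noInducedK₂+K₁ (S-alive p∈S) (S-alive p′∈S) y≢v p∈A p′∈A y∈A p∼p′
          (≁-sym G (I-S-anticomplete _ _ y∈I p∈S)) (≁-sym G (I-S-anticomplete _ _ y∈I p′∈S)))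

      C-neighbourOfI-inA : ∀ {u y} → part u ≡ C → u ≢ v → part y ≡ I → y ≢ v → u ∼[ G ] y → InA σ u
      C-neighbourOfI-inA u∈C u≢v y∈I y≢v u∼y with inA⊎inB σ _ | I-inB y∈I y≢v
      ... | inj₁ u∈A        | _         = u∈A
      ... | inj₂ (qu , σu)  | qy , σy   = ⊥-elim (I-notInClique y∈I y≢v
        (trans σy (cong inj₂ (trans (sym (B-∼⇒≡ u≢v y≢v σu σy u∼y)) (C-inB⇒inClique u∈C u≢v σu)))))

      |I|<k : part v ≢ I → length Is < k
      |I|<k v∉I = aliveI-inB⇒|I|<k v∉I λ _ → I-inB

      |I|≤k : length Is ≤ k
      |I|≤k = aliveI-inB⇒|I|≤k λ _ → I-inB

      noINeighbour : part v ≢ I → ¬ HasINeighbour x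
      noINeighbour v∉I (y , y∈I , x∼y) with C-neighbourOfI-inA x∈C x≢v y∈I (λ { refl → v∉I y∈I }) x∼y
      ... | i , σx′ = contradiction (trans (sym σx′) σx) λ ()

      C∩A-bound : ∀ {xs} → Unique xs → (∀ {u} → u ∈ xs → part u ≡ C × u ≢ v × InA σ u) → 2 + length xs ≤ s
      C∩A-bound xs-unique xs⊆C with S-edge-inA
      ... | p , p′ , p∈S , p′∈S , p∼p′ , p∈A , p′∈A = S∪C-clique-bound
        ((∼⇒≢ G p∼p′ All.∷ All.[]) ∷ All.[] ∷ [])
        (λ { (here refl) → p∈S , p∈A ; (there (here refl)) → p′∈S , p′∈A })
        (Clique-∷ G (λ { (here refl) → p∼p′ ; (there ()) }) (Clique-∷ G (λ ()) (λ ())))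
        xs-unique xs⊆C

    module IVertexInA {w : Fin n} {p : Fin s} (w∈I : part w ≡ I) (w≢v : w ≢ v) (σw : σ w ≡ inj₁ p) where

      S-inA⇒inPart : ∀ {r i} → part r ≡ S → σ r ≡ inj₁ i → i ≡ p
      S-inA⇒inPart r∈S σr = A-≁⇒≡ (S-alive r∈S) w≢v σr σw (≁-sym G (I-S-anticomplete _ _ w∈I r∈S))

      S-edge-endpointInB : ∀ {r r′} → part r ≡ S → part r′ ≡ S → r ∼[ G ] r′ →
                           ∃[ t ] (t ≡ r ⊎ t ≡ r′) × InB σ t
      S-edge-endpointInB {r} {r′} r∈S r′∈S r∼r′ with inA⊎inB σ r | inA⊎inB σ r′
      ... | inj₂ r∈B       | _               = r , inj₁ refl , r∈B
      ... | inj₁ _         | inj₂ r′∈B       = r′ , inj₂ refl , r′∈B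
      ... | inj₁ (i , σr)  | inj₁ (j , σr′)  = ⊥-elim (A-∼⇒≢ (S-alive r∈S) (S-alive r′∈S) σr σr′ r∼r′
                                                 (trans (S-inA⇒inPart r∈S σr) (sym (S-inA⇒inPart r′∈S σr′))))

      S-nonadjacentPair-inB : ∃₂ λ t t′ → part t ≡ S × part t′ ≡ S × t ≢ t′ × adj G t t′ ≡ false ×
                                          InB σ t × InB σ t′
      S-nonadjacentPair-inB with S-edge-endpointInB a∈S b∈S a∼b | S-edge-endpointInB c∈S d∈S c∼d
      ... | t , t∈ab , t∈B | t′ , t′∈cd , t′∈B =
        let t∈S , t′∈S , t≢t′ , t≁t′ = ab-cd-nonadjacent t∈ab t′∈cd
        in t , t′ , t∈S , t′∈S , t≢t′ , t≁t′ , t∈B , t′∈B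

      I∩B-bound : ∀ {ys} → Unique ys → (∀ {y} → y ∈ ys → part y ≡ I × y ≢ v × InB σ y) → 2 + length ys ≤ k
      I∩B-bound ys-unique ys⊆I with S-nonadjacentPair-inB
      ... | t , t′ , t∈S , t′∈S , t≢t′ , t≁t′ , t∈B , t′∈B = S∪I-independent-bound
        ((t≢t′ All.∷ All.[]) ∷ All.[] ∷ [])
        (λ { (here refl) → t∈S , t∈B ; (there (here refl)) → t′∈S , t′∈B })
        (Independent-∷ G (λ { (here refl) → t≁t′ ; (there ()) }) (Independent-∷ G (λ ()) (λ ())))
        ys-unique ys⊆I

      aliveI-inA⇒CTwin : ∀ {y i} → part y ≡ I → y ≢ v → σ y ≡ inj₁ i → part v ≢ C →
                         (∀ u → part u ≡ C → u ≢ v → InA σ u) → CTwins y w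
      aliveI-inA⇒CTwin y∈I y≢v σy v∉C C⊆A u u∈C = ⇔→≡ (mk⇔
        (λ u∼y → A-≢⇒∼ u≢v w≢v σu σw (subst (iu ≢_) i≡p (A-∼⇒≢ u≢v y≢v σu σy u∼y)))
        (λ u∼w → A-≢⇒∼ u≢v y≢v σu σy (subst (iu ≢_) (sym i≡p) (A-∼⇒≢ u≢v w≢v σu σw u∼w))))
        where
        i≡p = A-≁⇒≡ y≢v w≢v σy σw (I-independent _ _ y∈I w∈I)
        u≢v : u ≢ v
        u≢v refl = v∉C u∈C
        iu = proj₁ (C⊆A u u∈C u≢v)
        σu = proj₂ (C⊆A u u∈C u≢v)

    reinsertC : part v ≡ C → ¬ HasINeighbour v → ∀ {x q} → part x ≡ C → x ≢ v → σ x ≡ inj₂ q →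
              Polar s k G
    reinsertC v∈C v≁I {x} {q} x∈C x≢v σx = Extend.extendIntoClique away q atV
      where
      open CVertexInB x∈C x≢v σx
      atV : ∀ w j → w ≢ v → σ w ≡ inj₂ j → (v ∼[ G ] w ⇔ q ≡ j)
      atV w j w≢v σw with part w in w∈
      ... | C = mk⇔ (λ _ → sym (C-inB⇒inClique w∈ w≢v σw)) (λ _ → C-clique v w v∈C w∈ (≢-sym w≢v))
      ... | S = mk⇔ (λ _ → sym (S-inB⇒inClique w∈ σw)) (λ _ → C-S-complete v w v∈C w∈)
      ... | I = mk⇔ (λ v∼w → ⊥-elim (v≁I (w , w∈ , v∼w)))
                    (λ { refl → ⊥-elim (I-notInClique w∈ w≢v σw) })

    reinsertI : part v ≡ I → ∀ {w p} → part w ≡ I → w ≢ v → σ w ≡ inj₁ p → CTwins v w → Polar s k G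
    reinsertI v∈I {w} {p} w∈I w≢v σw twins = Extend.extendIntoPart away p atV
      where
      sameNeighbours : ∀ w′ → adj G v w′ ≡ adj G w w′
      sameNeighbours w′ with part w′ in w′∈
      ... | C = trans (adj-sym G v w′) (trans (twins w′ w′∈) (adj-sym G w′ w))
      ... | S = trans (I-S-anticomplete v w′ v∈I w′∈) (sym (I-S-anticomplete w w′ w∈I w′∈))
      ... | I = trans (I-independent v w′ v∈I w′∈) (sym (I-independent w w′ w∈I w′∈))
      atV : ∀ w′ j → w′ ≢ v → σ w′ ≡ inj₁ j → (v ∼[ G ] w′ ⇔ p ≢ j)
      atV w′ j w′≢v σw′ with w′ ≟ w
      ... | yes refl = mk⇔ (λ v∼w → ⊥-elim (∼⇒¬≁ G v∼w (I-independent v w v∈I w∈I)))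
                           (λ p≢j → ⊥-elim (p≢j (inj₁-injective (trans (sym σw) σw′))))
      ... | no w′≢w  = subst (λ b → (b ≡ true) ⇔ (p ≢ j)) (sym (sameNeighbours w′))
                             (multipartite away w w′ p j w≢v w′≢v σw σw′ (≢-sym w′≢w))

  module Obstruction {s k : ℕ} (notPolar : ¬ Polar s k G)
                     (awayFrom : ∀ v → ∃[ σ ] PolarLabellingAwayFrom s k G v σ) where

    someCInB-afterDeleting : ∀ {v} → part v ≡ C → suc (suc s) ≤ length Cs →
      ∃[ σ ] PolarLabellingAwayFrom s k G v σ × ∃[ x ] part x ≡ C × x ≢ v × InB σ x
    someCInB-afterDeleting {v} v∈C 2+s≤|C| with awayFrom v
    ... | σ , away with AwayFrom.someInB⊎allInA away isC?
    ...   | inj₁ x∈C∩B = σ , away , x∈C∩B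
    ...   | inj₂ C⊆A   = ⊥-elim (ℕ.≤⇒≯ (Away.aliveC-inA⇒|C|≤1+s (≡⇒≢ v∈C λ ()) away C⊆A) 2+s≤|C|)

    -- A C-vertex x in B after deleting v ∈ C would let v join the clique of x if v has no
    -- I-neighbour, and cannot exist at all if x has one.
    manyC : suc (suc s) ≤ length Cs → ⊥
    manyC 2+s≤|C| with Finₚ.any? (λ v → isC? v ×-dec ¬? (hasINeighbour? v))
    ... | yes (v , v∈C , v≁I) with someCInB-afterDeleting v∈C 2+s≤|C|
    ...   | σ , away , x , x∈C , x≢v , _ , σx =
      notPolar (Away.reinsertC (≡⇒≢ v∈C λ ()) away v∈C v≁I x∈C x≢v σx)
    manyC 2+s≤|C| | no noIsolatedC with someMember (ℕ.≤-trans (s≤s z≤n) 2+s≤|C|)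
    ... | v , v∈C with someCInB-afterDeleting v∈C 2+s≤|C|
    ...   | σ , away , x , x∈C , x≢v , _ , σx =
      Away.CVertexInB.noINeighbour (≡⇒≢ v∈C λ ()) away x∈C x≢v σx (≡⇒≢ v∈C λ ())
        (decidable-stable (hasINeighbour? x) λ x≁I → noIsolatedC (x , x∈C , x≁I))

    -- The C-vertices other than x₀ that are not adjacent to y share the part of y under σ′,
    -- so there is at most one; those adjacent to y lie in A under σ₁, next to an edge of S.
    C-bound-fromTwoDeletions : ∀ {x₀ y y₁ σ′ σ₁ x q} → part x₀ ≡ C → part y ≡ I → part y₁ ≡ I → y ≢ y₁ →
      (away′ : PolarLabellingAwayFrom s k G x₀ σ′) → (∀ u → part u ≡ C → u ≢ x₀ → InA σ′ u) → InA σ′ y →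
      (away₁ : PolarLabellingAwayFrom s k G y₁ σ₁) → part x ≡ C → x ≢ y₁ → σ₁ x ≡ inj₂ q →
      length Cs ≤ s
    C-bound-fromTwoDeletions {x₀} {y} {y₁} x₀∈C y∈I y₁∈I y≢y₁ away′ C⊆A′ y∈A′ away₁ x∈C x≢y₁ σ₁x =
      begin
      length Cs                  ≤⟨ length-≤-suc-without x₀ (members-unique C) ⟩
      suc (length rest)          ≤⟨ s≤s (length-≤-filter-++ adjacentToY? rest-unique) ⟩
      suc (length M + length N)  ≤⟨ s≤s (ℕ.+-monoʳ-≤ (length M) N-bound) ⟩
      suc (length M + 1)         ≡⟨ cong suc (ℕ.+-comm (length M) 1) ⟩
      2 + length M               ≤⟨ M-bound ⟩
      s                          ∎
      where
      open ℕ.≤-Reasoning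
      module A′ = Away (≡⇒≢ x₀∈C λ ()) away′
      module A₁ = Away (≡⇒≢ y₁∈I λ ()) away₁
      rest = without x₀ Cs
      rest-unique = without-unique x₀ (members-unique C)
      adjacentToY? = λ u → adj G u y ≟ᵇ true
      M = filter adjacentToY? rest
      N = filter (¬? ∘ adjacentToY?) rest
      N-bound : length N ≤ 1
      N-bound = A′.C-nonNeighbours-bound (part-≢ y∈I x₀∈C λ ()) y∈A′
        (filter⁺ (¬? ∘ adjacentToY?) rest-unique) λ u∈ →
        let u∈rest , u≁y = ∈-filter⁻ (¬? ∘ adjacentToY?) {xs = rest} u∈
            u∈C , u≢x₀ = ∈-without-members⁻ u∈rest
        in u∈C , u≢x₀ , C⊆A′ _ u∈C u≢x₀ , ¬-not u≁y
      M-bound : 2 + length M ≤ s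
      M-bound = A₁.CVertexInB.C∩A-bound x∈C x≢y₁ σ₁x (filter⁺ adjacentToY? rest-unique) λ u∈ →
        let u∈rest , u∼y = ∈-filter⁻ adjacentToY? {xs = rest} u∈
            u∈C = proj₁ (∈-without-members⁻ u∈rest)
            u≢y₁ = part-≢ u∈C y₁∈I λ ()
        in u∈C , u≢y₁ , A₁.CVertexInB.C-neighbourOfI-inA x∈C x≢y₁ σ₁x u∈C u≢y₁ y∈I y≢y₁ u∼y

    manyCAndI : 2 ≤ k → suc s ≤ length Cs → k ≤ length Is → ⊥
    manyCAndI 2≤k s<|C| k≤|I| with someMember (ℕ.≤-trans (s≤s z≤n) s<|C|)
    ... | x₀ , x₀∈C with awayFrom x₀
    ...   | σ′ , away′ with AwayFrom.someInB⊎allInA away′ isC? | AwayFrom.someInA⊎allInB away′ isI?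
    ...     | inj₁ (x , x∈C , x≢x₀ , _ , σ′x) | _ =
      ℕ.≤⇒≯ k≤|I| (Away.CVertexInB.|I|<k (≡⇒≢ x₀∈C λ ()) away′ x∈C x≢x₀ σ′x (≡⇒≢ x₀∈C λ ()))
    ...     | inj₂ _ | inj₂ I⊆B = ℕ.≤⇒≯ k≤|I| (Away.aliveI-inB⇒|I|<k (≡⇒≢ x₀∈C λ ()) away′ (≡⇒≢ x₀∈C λ ()) I⊆B)
    ...     | inj₂ C⊆A′ | inj₁ (y , y∈I , _ , y∈A′) with someMemberOtherThan (ℕ.≤-trans 2≤k k≤|I|) y
    ...       | y₁ , y₁∈I , y₁≢y with awayFrom y₁
    ...         | σ₁ , away₁ with AwayFrom.someInB⊎allInA away₁ isC?
    ...           | inj₂ C⊆A₁ = ℕ.≤⇒≯ (Away.aliveC-inA⇒|C|≤s (≡⇒≢ y₁∈I λ ()) away₁ (≡⇒≢ y₁∈I λ ()) C⊆A₁) s<|C|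
    ...           | inj₁ (x , x∈C , x≢y₁ , _ , σ₁x) = ℕ.≤⇒≯
      (C-bound-fromTwoDeletions x₀∈C y∈I y₁∈I (≢-sym y₁≢y) away′ C⊆A′ y∈A′ away₁ x∈C x≢y₁ σ₁x) s<|C|

    record IDeletion (v : Fin n) : Set where
      field
        σ         : Fin n → Fin s ⊎ Fin k
        away      : PolarLabellingAwayFrom s k G v σ
        C-inA     : ∀ u → part u ≡ C → u ≢ v → InA σ u
        {w}       : Fin n
        w∈I       : part w ≡ I
        w≢v       : w ≢ v
        {p}       : Fin s
        σw        : σ w ≡ inj₁ p
        notCTwins : ¬ CTwins v w

    -- If v were a C-twin of w, it could join the part of w.
    deleteI : 2 ≤ k → k + k ≤ suc (length Is) → ∀ {v} → part v ≡ I → IDeletion v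
    deleteI 2≤k 2k≤1+|I| {v} v∈I with awayFrom v
    ... | σ , away with AwayFrom.someInB⊎allInA away isC? | AwayFrom.someInA⊎allInB away isI?
    ...   | inj₁ (x , x∈C , x≢v , _ , σx) | _ =
      ⊥-elim (twiceNotBelow 2≤k 2k≤1+|I| (Away.CVertexInB.|I|≤k (≡⇒≢ v∈I λ ()) away x∈C x≢v σx))
    ...   | inj₂ _ | inj₂ I⊆B = ⊥-elim (twiceNotBelow 2≤k 2k≤1+|I| (Away.aliveI-inB⇒|I|≤k (≡⇒≢ v∈I λ ()) away I⊆B))
    ...   | inj₂ C⊆A | inj₁ (w , w∈I , w≢v , p , σw) with cTwins? v w
    ...     | yes twins = ⊥-elim (notPolar (Away.reinsertI (≡⇒≢ v∈I λ ()) away v∈I w∈I w≢v σw twins))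
    ...     | no ¬twins = record
      { σ = σ ; away = away ; C-inA = C⊆A ; w∈I = w∈I ; w≢v = w≢v ; σw = σw ; notCTwins = ¬twins }

    -- Such a vertex would be a C-twin of both w₁ and w₂.
    notInA-underBoth : ∀ {v₁} → part v₁ ≡ I → (d₁ : IDeletion v₁) → (d₂ : IDeletion (IDeletion.w d₁)) →
      ∀ {y} → part y ≡ I → y ≢ v₁ → y ≢ IDeletion.w d₁ → InA (IDeletion.σ d₁) y → InA (IDeletion.σ d₂) y → ⊥
    notInA-underBoth v₁∈I d₁ d₂ y∈I y≢v₁ y≢w₁ (_ , σ₁y) (_ , σ₂y) = D₂.notCTwins λ u u∈C → trans
      (sym (A₁.IVertexInA.aliveI-inA⇒CTwin D₁.w∈I D₁.w≢v D₁.σw y∈I y≢v₁ σ₁y (≡⇒≢ v₁∈I λ ()) D₁.C-inA u u∈C))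
      (A₂.IVertexInA.aliveI-inA⇒CTwin D₂.w∈I D₂.w≢v D₂.σw y∈I y≢w₁ σ₂y (≡⇒≢ D₁.w∈I λ ()) D₂.C-inA u u∈C)
      where
      module D₁ = IDeletion d₁
      module D₂ = IDeletion d₂
      module A₁ = Away (≡⇒≢ v₁∈I λ ()) D₁.away
      module A₂ = Away (≡⇒≢ D₁.w∈I λ ()) D₂.away

    I-bound-fromTwoDeletions : ∀ {v₁} → part v₁ ≡ I → (d₁ : IDeletion v₁) → IDeletion (IDeletion.w d₁) →
                               2 + length Is ≤ k + k
    I-bound-fromTwoDeletions {v₁} v₁∈I d₁ d₂ = begin
      2 + length Is                    ≤⟨ s≤s (s≤s (length-≤-suc-without v₁ (members-unique I))) ⟩
      3 + length (without v₁ Is)       ≤⟨ ℕ.+-monoʳ-≤ 3 (length-≤-suc-without w₁ (without-unique v₁ (members-unique I))) ⟩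
      4 + length R                     ≤⟨ ℕ.+-monoʳ-≤ 4 (length-≤-filter-++ (inB? σ₁) R-unique) ⟩
      4 + (length P + length Q)        ≡⟨ regroup (length P) (length Q) ⟩
      (2 + length P) + (2 + length Q)  ≤⟨ ℕ.+-mono-≤ P-bound Q-bound ⟩
      k + k                            ∎
      where
      open ℕ.≤-Reasoning
      module D₁ = IDeletion d₁
      module D₂ = IDeletion d₂
      module A₁ = Away (≡⇒≢ v₁∈I λ ()) D₁.away
      module A₂ = Away (≡⇒≢ D₁.w∈I λ ()) D₂.away
      w₁ = D₁.w
      σ₁ = D₁.σ
      σ₂ = D₂.σ
      regroup : ∀ a b → 4 + (a + b) ≡ (2 + a) + (2 + b)
      regroup = solve-∀
      R = without w₁ (without v₁ Is)
      R-unique = without-unique w₁ (without-unique v₁ (members-unique I))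
      ∈-R⁻ : ∀ {y} → y ∈ R → part y ≡ I × y ≢ v₁ × y ≢ w₁
      ∈-R⁻ y∈ = let y∈′ , y≢w₁ = ∈-without⁻ y∈ ; y∈I , y≢v₁ = ∈-without-members⁻ y∈′ in y∈I , y≢v₁ , y≢w₁
      P = filter (inB? σ₁) R
      Q = filter (¬? ∘ inB? σ₁) R
      P-bound : 2 + length P ≤ k
      P-bound = A₁.IVertexInA.I∩B-bound D₁.w∈I D₁.w≢v D₁.σw (filter⁺ (inB? σ₁) R-unique) λ y∈ →
        let y∈R , y∈B₁ = ∈-filter⁻ (inB? σ₁) {xs = R} y∈ ; y∈I , y≢v₁ , _ = ∈-R⁻ y∈R
        in y∈I , y≢v₁ , y∈B₁
      Q-inB : ∀ {y} → y ∈ Q → InB σ₂ y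
      Q-inB y∈ with ∈-filter⁻ (¬? ∘ inB? σ₁) {xs = R} y∈
      ... | y∈R , y∉B₁ with ∈-R⁻ y∈R | inA⊎inB σ₁ _ | inA⊎inB σ₂ _
      ...   | _ , _ , _ | inj₂ y∈B₁ | _ = ⊥-elim (y∉B₁ y∈B₁)
      ...   | _ , _ , _ | inj₁ _ | inj₂ y∈B₂ = y∈B₂
      ...   | y∈I , y≢v₁ , y≢w₁ | inj₁ y∈A₁ | inj₁ y∈A₂ =
        ⊥-elim (notInA-underBoth v₁∈I d₁ d₂ y∈I y≢v₁ y≢w₁ y∈A₁ y∈A₂)
      Q-bound : 2 + length Q ≤ k
      Q-bound = A₂.IVertexInA.I∩B-bound D₂.w∈I D₂.w≢v D₂.σw (filter⁺ (¬? ∘ inB? σ₁) R-unique) λ y∈ →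
        let y∈R , _ = ∈-filter⁻ (¬? ∘ inB? σ₁) {xs = R} y∈ ; y∈I , _ , y≢w₁ = ∈-R⁻ y∈R
        in y∈I , y≢w₁ , Q-inB y∈

    manyI : 2 ≤ k → k + k ≤ suc (length Is) → ⊥
    manyI 2≤k 2k≤1+|I| with someMember (ℕ.≤-pred (ℕ.≤-trans (ℕ.≤-trans 2≤k (ℕ.m≤m+n k k)) 2k≤1+|I|))
    ... | v₁ , v₁∈I = ℕ.≤⇒≯ 2k≤1+|I| (I-bound-fromTwoDeletions v₁∈I d₁ (deleteI 2≤k 2k≤1+|I| (IDeletion.w∈I d₁)))
      where
      d₁ = deleteI 2≤k 2k≤1+|I| v₁∈I

    bound : 2 ≤ k → (∀ x → part x ≡ S → (x ≡ a ⊎ x ≡ b) ⊎ (x ≡ c ⊎ x ≡ d)) → n ≤ s + 2 * k + 2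
    bound 2≤k S⊆abcd with n ℕ.≤? s + 2 * k + 2
    ... | yes n≤ = n≤
    ... | no n≰ with sizeCases 2≤k (ℕ.<-≤-trans (ℕ.≰⇒> n≰) (vertexCount S⊆abcd))
    ...   | inj₁ 2k≤1+|I|                 = ⊥-elim (manyI 2≤k 2k≤1+|I|)
    ...   | inj₂ (inj₁ (s<|C| , k≤|I|))   = ⊥-elim (manyCAndI 2≤k s<|C| k≤|I|)
    ...   | inj₂ (inj₂ 2+s≤|C|)          = ⊥-elim (manyC 2+s≤|C|)

mainTheorem14 : (s k : ℕ) → 2 ≤ s → 2 ≤ k → (n : ℕ) (G : Graph n) →
    TwoK2Split G → MinimalObstruction s k G → n ≤ s + 2 * k + 2
mainTheorem14 s k 2≤s 2≤k zero G _ _ = z≤n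
mainTheorem14 s k 2≤s 2≤k (suc m) G (part , C-clique , I-independent , inj₁ S-empty , _) (notPolar , _) =
  ⊥-elim (notPolar (splitGraph-polar G part (fromℕ< 2≤s) (fromℕ< 2≤k) C-clique I-independent S-empty))
mainTheorem14 s k 2≤s 2≤k (suc m) G
  (part , C-clique , I-independent , inj₂ (a , b , c , d , _ , a≢c , a≢d , b≢c , b≢d , _ , S≡abcd ,
          a∼b , c∼d , a≁c , a≁d , b≁c , b≁d) , C-S-complete , I-S-anticomplete)
  (notPolar , deletionsPolar) =
  Obstruction.bound notPolar awayFrom 2≤k (Equivalence.to ∘ S≡abcd)
  where
  open Split G part C-clique I-independent C-S-complete I-S-anticomplete
    (Equivalence.from (S≡abcd a) (inj₁ (inj₁ refl))) (Equivalence.from (S≡abcd b) (inj₁ (inj₂ refl)))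
    (Equivalence.from (S≡abcd c) (inj₂ (inj₁ refl))) (Equivalence.from (S≡abcd d) (inj₂ (inj₂ refl)))
    a≢c a≢d b≢c b≢d a∼b c∼d a≁c a≁d b≁c b≁d
  awayFrom : ∀ v → ∃[ σ ] PolarLabellingAwayFrom s k G v σ
  awayFrom v = polarAwayFrom-delete G v (fromℕ< 2≤s) (deletionsPolar v)
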